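{- Let $G$ be a directed graph, $T\subseteq V(G)$, and $\mathcal{F}$ a $T$-connected set of subgraphs of $G$. If $W$ is a minimum $\mathcal{F}$-transversal, then no $v\in W$ is in the reverse shadow (with respect to $T$) of some $W'\subseteq W\setminus\{v\}$.
   Context: For disjoint nonempty $A,B\subseteq V(G)$, a set $X\subseteq V(G)\setminus(A\cup B)$ is an $A-B$ separator if $G\setminus X$ has no path from $A$ to $B$. The reverse shadow of $X$ with respect to $T$ is the set of vertices $v$ such that $X$ is a $\{v\}-T$ separator. For $\mathcal{F}=\{F_1,\dots,F_q\}$ a set of subgraphs of $G$: $\mathcal{F}$ is $T$-connected if for every $i$, each vertex of $F_i$ can reach some vertex of $T$ by a walk completely contained in $F_i$ and is reachable from some vertex of $T$ by a walk completely contained in $F_i$; a set $W\subseteq V(G)$ is an $\mathcal{F}$-transversal if $W\cap F_i\ne\emptyset$ for all $i$; it is minimum if there is no $\mathcal{F}$-transversal of smaller size. -}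

module Defs where

open import Level using (0ℓ)
open import Data.Nat using (ℕ; _≤_)
open import Data.Fin using (Fin)
open import Data.Fin.Subset using (Subset; _∈_; _∉_; _⊆_; ∣_∣)
open import Data.Product using (Σ; ∃; _×_)
open import Relation.Nullary using (¬_)
open import Relation.Binary.Construct.Closure.ReflexiveTransitive using (Star)

record Digraph (n : ℕ) : Set₁ where
  field
    Edge : Fin n → Fin n → Set

open Digraph public

record Subgraph {n : ℕ} (G : Digraph n) : Set₁ where
  field
    V      : Subset n
    E      : Fin n → Fin n → Set
    E⊆     : ∀ {u w} → E u w → Edge G u w
    E-ends : ∀ {u w} → E u w → (u ∈ V) × (w ∈ V)

open Subgraph public

TConnectedSubgraph : ∀ {n} {G : Digraph n} → Subset n → Subgraph G → Set
TConnectedSubgraph T F =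
  ∀ v → v ∈ V F →
    (∃ λ t → t ∈ T × Star (E F) v t) × (∃ λ t → t ∈ T × Star (E F) t v)

TConnected : ∀ {n q} {G : Digraph n} → Subset n → (Fin q → Subgraph G) → Set
TConnected T 𝓕 = ∀ i → TConnectedSubgraph T (𝓕 i)

Transversal : ∀ {n q} {G : Digraph n} → (Fin q → Subgraph G) → Subset n → Set
Transversal 𝓕 W = ∀ i → ∃ λ v → v ∈ W × v ∈ V (𝓕 i)

MinimumTransversal : ∀ {n q} {G : Digraph n} → (Fin q → Subgraph G) → Subset n → Set
MinimumTransversal 𝓕 W =
  Transversal 𝓕 W × (∀ W′ → Transversal 𝓕 W′ → ∣ W ∣ ≤ ∣ W′ ∣)

EdgeAvoiding : ∀ {n} → Digraph n → Subset n → Fin n → Fin n → Set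
EdgeAvoiding G X u w = Edge G u w × u ∉ X × w ∉ X

Separator : ∀ {n} → Digraph n → Subset n → Subset n → Subset n → Set
Separator G A B X =
  (∀ v → v ∈ A → v ∉ B) ×
  (∃ λ a → a ∈ A) × (∃ λ b → b ∈ B) ×
  (∀ v → v ∈ X → v ∉ A × v ∉ B) ×
  (∀ a b → a ∈ A → b ∈ B → ¬ Star (EdgeAvoiding G X) a b)

open import Data.Fin.Subset using (⁅_⁆) public

InReverseShadow : ∀ {n} → Digraph n → Subset n → Subset n → Fin n → Set
InReverseShadow G T X v = Separator G ⁅ v ⁆ T X

module Submission where

-- Suppose v ∈ W lies in the reverse shadow of some W′ ⊆ W ∖ {v}
-- with respect to T, i.e. every walk from v to T meets W′.  Take any member F
-- of the family containing v.  Since F is T-connected, v reaches some t ∈ T by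
-- a walk inside F; that walk must meet W′, and it does so at a vertex of F.
-- Hence every member of the family hit by v is also hit by W′ ⊆ W ∖ {v}, so
-- W ∖ {v} is still a transversal.  It is strictly smaller than W, contradicting
-- minimality.

open import Defs
open import Data.Fin using (Fin; _≟_)
open import Data.Fin.Subset using (Subset; _∈_; _∉_; _⊆_; _-_)
open import Data.Fin.Subset.Properties
  using (_∈?_; x∈p∧x≢y⇒x∈p-y; x∈p⇒∣p-x∣<∣p∣; x∈⁅x⁆)
open import Data.Nat.Properties using (<⇒≱)
open import Data.Product using (∃; _×_; _,_; proj₁; proj₂)
open import Data.Sum using (_⊎_; inj₁; inj₂)
open import Data.Empty using (⊥-elim)
open import Relation.Nullary using (¬_; yes; no)
open import Relation.Binary.PropositionalEquality using (refl)
open import Relation.Binary.Construct.Closure.ReflexiveTransitive using (Star; ε; _◅_)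

Meets : ∀ {n} {G : Digraph n} → Subgraph G → Subset n → Set
Meets F X = ∃ λ x → x ∈ X × x ∈ V F

-- The extra conjunct a ∉ X is the invariant that lets
-- each edge of the walk be shown to avoid X at both endpoints.
walk-meets-or-avoids : ∀ {n} {G : Digraph n} (F : Subgraph G) (X : Subset n) {a b} →
                       a ∈ V F → Star (E F) a b →
                       Meets F X ⊎ (a ∉ X × Star (EdgeAvoiding G X) a b)
walk-meets-or-avoids F X {a} a∈F walk with a ∈? X
... | yes a∈X = inj₁ (a , a∈X , a∈F)
walk-meets-or-avoids F X a∈F ε        | no a∉X = inj₂ (a∉X , ε)
walk-meets-or-avoids F X a∈F (e ◅ es) | no a∉X
  with walk-meets-or-avoids F X (proj₂ (E-ends F e)) es
... | inj₁ meets          = inj₁ meets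
... | inj₂ (w∉X , avoid) = inj₂ (a∉X , (E⊆ F e , a∉X , w∉X) ◅ avoid)

shadow-vertex-forces-meeting : ∀ {n} {G : Digraph n} {T X : Subset n} {v}
                               (F : Subgraph G) → TConnectedSubgraph T F →
                               InReverseShadow G T X v → v ∈ V F → Meets F X
shadow-vertex-forces-meeting {v = v} F conn (_ , _ , _ , _ , noPath) v∈F
  with proj₁ (conn v v∈F)
... | t , t∈T , walk with walk-meets-or-avoids F _ v∈F walk
...   | inj₁ meets      = meets
...   | inj₂ (_ , avoid) = ⊥-elim (noPath v t (x∈⁅x⁆ v) t∈T avoid)

drop-covered-vertex : ∀ {n q} {G : Digraph n} (𝓕 : Fin q → Subgraph G) {W X : Subset n} {v} →
                      Transversal 𝓕 W → X ⊆ W → v ∉ X →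
                      (∀ i → v ∈ V (𝓕 i) → Meets (𝓕 i) X) →
                      Transversal 𝓕 (W - v)
drop-covered-vertex 𝓕 {v = v} tr X⊆W v∉X covered i with tr i
... | u , u∈W , u∈F with u ≟ v
...   | no u≢v   = u , x∈p∧x≢y⇒x∈p-y u∈W u≢v , u∈F
...   | yes refl with covered i u∈F
...     | x , x∈X , x∈F = x , x∈p∧x≢y⇒x∈p-y (X⊆W x∈X) (λ { refl → v∉X x∈X }) , x∈F

minimum-has-no-redundant-vertex : ∀ {n q} {G : Digraph n} (𝓕 : Fin q → Subgraph G) {W : Subset n} {v} →
                                  MinimumTransversal 𝓕 W → v ∈ W → ¬ Transversal 𝓕 (W - v)
minimum-has-no-redundant-vertex 𝓕 (_ , minimal) v∈W tr =
  <⇒≱ (x∈p⇒∣p-x∣<∣p∣ v∈W) (minimal _ tr)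

lemma6 : ∀ {n q} (G : Digraph n) (T : Subset n) (𝓕 : Fin q → Subgraph G) →
           TConnected T 𝓕 → (W : Subset n) → MinimumTransversal 𝓕 W →
           ∀ v → v ∈ W → ∀ (W′ : Subset n) → W′ ⊆ W → v ∉ W′ →
           ¬ InReverseShadow G T W′ v
lemma6 G T 𝓕 conn W minimum v v∈W W′ W′⊆W v∉W′ shadow =
  minimum-has-no-redundant-vertex 𝓕 minimum v∈W
    (drop-covered-vertex 𝓕 (proj₁ minimum) W′⊆W v∉W′ coveredByW′)
  where
  coveredByW′ : ∀ i → v ∈ V (𝓕 i) → Meets (𝓕 i) W′
  coveredByW′ i = shadow-vertex-forces-meeting (𝓕 i) (conn i) shadow
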